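{- For every $u\le w$ in the Bruhat order of $S_n$, the Bruhat interval $[u,w]$ contains a greedy chain.
   Context: $S_n$ is the symmetric group on $[n]$; $\ell(w)$ is the number of inversions of $w$. For $a<b$, $wt_{ab}$ swaps entries of $w$ in positions $a,b$. Bruhat covers: $u\lessdot v$ iff $v=ut_{ab}$ ($a<b$) and $\ell(v)=\ell(u)+1$; $[u,w]$ is the set of $v$ with $u\le v\le w$. A saturated chain $u=w_0\lessdot w_1\lessdot\cdots\lessdot w_\ell=w$ is greedy if for every $i\in[\ell]$, writing $w_i=w_{i-1}t_{ab}$ with $a<b$, there is no $w'_{i-1}\in[u,w]$ with $w'_{i-1}\lessdot w_i$ such that either $w_i=w'_{i-1}t_{ab'}$ for some $b'>b$, or $w_i=w'_{i-1}t_{a'b}$ for some $a'<a$. -}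

module Defs where

open import Data.Nat using (ℕ; suc; _<_)
open import Data.Fin as Fin using (Fin)
open import Data.Vec using (Vec; lookup; _[_]≔_)
open import Data.List using (List; length; filter; cartesianProduct; allFin)
open import Data.Product using (Σ; ∃; ∃-syntax; _×_; _,_; proj₁; proj₂)
open import Data.Sum using (_⊎_)
open import Relation.Nullary using (¬_)
open import Relation.Nullary.Decidable using (_×-dec_)
open import Relation.Binary.PropositionalEquality using (_≡_)
open import Relation.Binary.Construct.Closure.ReflexiveTransitive using (Star)

-- A permutation of [n] in one-line notation: w = (w(1),...,w(n)), entries in Fin n.
Word : ℕ → Set
Word n = Vec (Fin n) n

-- w is a permutation (injective, hence bijective on Fin n): w ∈ S_n
IsPerm : ∀ {n} → Word n → Set
IsPerm {n} w = ∀ (i j : Fin n) → lookup w i ≡ lookup w j → i ≡ j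

ℓ : ∀ {n} → Word n → ℕ
ℓ {n} w = length (filter (λ p → (proj₁ p Fin.<? proj₂ p)
                                 ×-dec (lookup w (proj₂ p) Fin.<? lookup w (proj₁ p)))
                         (cartesianProduct (allFin n) (allFin n)))

_t[_,_] : ∀ {n} → Word n → Fin n → Fin n → Word n
w t[ a , b ] = (w [ a ]≔ lookup w b) [ b ]≔ lookup w a

BruhatStep : ∀ {n} → Word n → Word n → Set
BruhatStep {n} u v = ∃[ a ] ∃[ b ] (a Fin.< b × v ≡ u t[ a , b ] × ℓ u < ℓ v)

_≤B_ : ∀ {n} → Word n → Word n → Set
u ≤B v = Star BruhatStep u v

_⋖_ : ∀ {n} → Word n → Word n → Set
u ⋖ v = ∃[ a ] ∃[ b ] (a Fin.< b × v ≡ u t[ a , b ] × ℓ v ≡ suc (ℓ u))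

_∈[_,_] : ∀ {n} → Word n → Word n → Word n → Set
v ∈[ u , w ] = u ≤B v × v ≤B w

GreedyStep : ∀ {n} → (u w : Word n) → (wi : Word n) → (a b : Fin n) → Set
GreedyStep {n} u w wi a b =
  ¬ (Σ (Word n) λ w' → w' ∈[ u , w ] × w' ⋖ wi ×
       ((∃[ b' ] (b Fin.< b' × wi ≡ w' t[ a , b' ]))
        ⊎ (∃[ a' ] (a' Fin.< a × wi ≡ w' t[ a' , b ]))))

data GreedyChain {n} (u w : Word n) : Word n → Set where
  start : GreedyChain u w u
  step  : ∀ {x y} → GreedyChain u w x → (a b : Fin n) → a Fin.< b →
          y ≡ x t[ a , b ] → ℓ y ≡ suc (ℓ x) → GreedyStep u w y a b →
          GreedyChain u w y

-- The chain is built from the top.  If u < x ≤ w, choose among the transpositions t_ab with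
-- x t_ab ⋖ x and u ≤ x t_ab one with a least and then b greatest: the step x t_ab ⋖ x is then
-- greedy by construction, and we recurse below x t_ab.  Such a t_ab exists because every Bruhat
-- step z < z t_ab can be refined to end in a cover: ℓ (z t_ab) = ℓ z + 1 + 2 #{a < c < b :
-- z a < z c < z b}, and if some c lies in between, t_ab = t_ac t_cb t_ac with the first two
-- steps going up.  The choice is effective because u ≤ v is decided by a search bounded by ℓ.
module Submission where

open import Defs
open import Data.Bool as Bool using (Bool; true; false; if_then_else_; _∧_; _∨_; not; _xor_; f≤t; b≤b)
open import Data.Empty using (⊥-elim)
open import Data.Fin as Fin using (Fin; _≟_; _<_; _<?_)
open import Data.Fin.Induction as Fin using ()
open import Data.Fin.Permutation.Components using (transpose)
open import Data.Fin.Properties as Fin using (<-cmp; <-irrefl; <-asym; <⇒≢; any?)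
open import Data.List as List using (length; filter; cartesianProduct; _++_)
open import Data.List.Properties using (length-++; filter-++; map-tabulate)
open import Data.Nat as ℕ using (ℕ; zero; suc; _+_; _*_; _≤_; s≤s)
open import Data.Nat.Induction as ℕ using ()
open import Data.Nat.Properties as ℕ using (+-identityʳ; m≤m+n; ≤-reflexive; ≤-trans; <⇒≤)
open import Data.Nat.Tactic.RingSolver using (solve-∀)
open import Algebra.Properties.Semiring.Sum ℕ.+-*-semiring
  using (sum; sum-syntax; ∑-distrib-+; sum-cong-≗; *-distribˡ-sum; sum-replicate-zero)
open import Data.Product using (∃-syntax; _×_; _,_; proj₁; proj₂)
open import Data.Sum using (_⊎_; inj₁; inj₂)
open import Data.Vec as Vec using (Vec; lookup; _[_]≔_)
open import Data.Vec.Properties using (lookup∘update; lookup∘update′; tabulate∘lookup; tabulate-cong; ≡-dec)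
open import Function using (_∘_; _on_)
open import Induction.WellFounded using (WellFounded; Acc; acc)
open import Relation.Binary using (Rel; Decidable; tri<; tri≈; tri>)
open import Relation.Binary.Construct.Closure.ReflexiveTransitive using (Star; ε; _◅_; _◅◅_)
import Relation.Binary.Construct.On as On
open import Relation.Binary.PropositionalEquality
open import Relation.Nullary using (Dec; does; yes; no; ¬_)
open import Relation.Nullary.Decidable using (_×-dec_; dec-true; dec-false; toSum; map′)
open import Relation.Unary using (Pred)
import Relation.Unary as U

private variable
  m n : ℕ
  A B : Set

-- Transpositions

transpose-matchˡ : (a b : Fin n) → transpose a b a ≡ b
transpose-matchˡ a b rewrite dec-true (a ≟ a) refl = refl

transpose-matchʳ : (a b : Fin n) → transpose a b b ≡ a
transpose-matchʳ a b with b ≟ a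
... | yes refl = refl
... | no _ rewrite dec-true (b ≟ b) refl = refl

transpose-fixed : {a b c : Fin n} → c ≢ a → c ≢ b → transpose a b c ≡ c
transpose-fixed {a = a} {b} {c} c≢a c≢b rewrite dec-false (c ≟ a) c≢a | dec-false (c ≟ b) c≢b = refl

transpose-involutive : (a b c : Fin n) → transpose a b (transpose a b c) ≡ c
transpose-involutive a b c with toSum (c ≟ a) | toSum (c ≟ b)
... | inj₁ refl | _ = trans (cong (transpose c b) (transpose-matchˡ c b)) (transpose-matchʳ c b)
... | inj₂ _ | inj₁ refl = trans (cong (transpose a c) (transpose-matchʳ a c)) (transpose-matchˡ a c)
... | inj₂ c≢a | inj₂ c≢b = trans (cong (transpose a b) (transpose-fixed c≢a c≢b)) (transpose-fixed c≢a c≢b)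

transpose-conjugate : {a b c : Fin n} → a ≢ c → c ≢ b → a ≢ b →
                      ∀ i → transpose a c (transpose c b (transpose a c i)) ≡ transpose a b i
transpose-conjugate {a = a} {b} {c} a≢c c≢b a≢b i with toSum (i ≟ a) | toSum (i ≟ b) | toSum (i ≟ c)
... | inj₁ refl | _ | _ = begin
  transpose i c (transpose c b (transpose i c i)) ≡⟨ cong (transpose i c ∘ transpose c b) (transpose-matchˡ i c) ⟩
  transpose i c (transpose c b c)                 ≡⟨ cong (transpose i c) (transpose-matchˡ c b) ⟩
  transpose i c b                                 ≡⟨ transpose-fixed (a≢b ∘ sym) (c≢b ∘ sym) ⟩
  b                                               ≡⟨ transpose-matchˡ i b ⟨
  transpose i b i                                 ∎
  where open ≡-Reasoning
... | inj₂ i≢a | inj₁ refl | _ = begin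
  transpose a c (transpose c i (transpose a c i)) ≡⟨ cong (transpose a c ∘ transpose c i) (transpose-fixed i≢a (c≢b ∘ sym)) ⟩
  transpose a c (transpose c i i)                 ≡⟨ cong (transpose a c) (transpose-matchʳ c i) ⟩
  transpose a c c                                 ≡⟨ transpose-matchʳ a c ⟩
  a                                               ≡⟨ transpose-matchʳ a i ⟨
  transpose a i i                                 ∎
  where open ≡-Reasoning
... | inj₂ i≢a | inj₂ i≢b | inj₁ refl = begin
  transpose a i (transpose i b (transpose a i i)) ≡⟨ cong (transpose a i ∘ transpose i b) (transpose-matchʳ a i) ⟩
  transpose a i (transpose i b a)                 ≡⟨ cong (transpose a i) (transpose-fixed a≢c a≢b) ⟩
  transpose a i a                                 ≡⟨ transpose-matchˡ a i ⟩
  i                                               ≡⟨ transpose-fixed i≢a i≢b ⟨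
  transpose a b i                                 ∎
  where open ≡-Reasoning
... | inj₂ i≢a | inj₂ i≢b | inj₂ i≢c = begin
  transpose a c (transpose c b (transpose a c i)) ≡⟨ cong (transpose a c ∘ transpose c b) (transpose-fixed i≢a i≢c) ⟩
  transpose a c (transpose c b i)                 ≡⟨ cong (transpose a c) (transpose-fixed i≢c i≢b) ⟩
  transpose a c i                                 ≡⟨ transpose-fixed i≢a i≢c ⟩
  i                                               ≡⟨ transpose-fixed i≢a i≢b ⟨
  transpose a b i                                 ∎
  where open ≡-Reasoning

lookup-ext : ∀ {A : Set} (xs ys : Vec A n) → (∀ i → lookup xs i ≡ lookup ys i) → xs ≡ ys
lookup-ext xs ys eq = begin
  xs                       ≡⟨ tabulate∘lookup xs ⟨
  Vec.tabulate (lookup xs) ≡⟨ tabulate-cong eq ⟩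
  Vec.tabulate (lookup ys) ≡⟨ tabulate∘lookup ys ⟩
  ys                       ∎
  where open ≡-Reasoning

lookup-t : (w : Word n) (a b i : Fin n) → lookup (w t[ a , b ]) i ≡ lookup w (transpose a b i)
lookup-t w a b i with toSum (i ≟ b) | toSum (i ≟ a)
... | inj₁ refl | _ = trans (lookup∘update i (w [ a ]≔ lookup w i) (lookup w a))
                           (cong (lookup w) (sym (transpose-matchʳ a i)))
... | inj₂ i≢b | inj₁ refl = begin
  lookup (w t[ i , b ]) i         ≡⟨ lookup∘update′ i≢b (w [ i ]≔ lookup w b) (lookup w i) ⟩
  lookup (w [ i ]≔ lookup w b) i ≡⟨ lookup∘update i w (lookup w b) ⟩
  lookup w b                      ≡⟨ cong (lookup w) (transpose-matchˡ i b) ⟨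
  lookup w (transpose i b i)      ∎
  where open ≡-Reasoning
... | inj₂ i≢b | inj₂ i≢a = begin
  lookup (w t[ a , b ]) i         ≡⟨ lookup∘update′ i≢b (w [ a ]≔ lookup w b) (lookup w a) ⟩
  lookup (w [ a ]≔ lookup w b) i ≡⟨ lookup∘update′ i≢a w (lookup w b) ⟩
  lookup w i                      ≡⟨ cong (lookup w) (transpose-fixed i≢a i≢b) ⟨
  lookup w (transpose a b i)      ∎
  where open ≡-Reasoning

lookup-t-matchˡ : (w : Word n) (a b : Fin n) → lookup (w t[ a , b ]) a ≡ lookup w b
lookup-t-matchˡ w a b = trans (lookup-t w a b a) (cong (lookup w) (transpose-matchˡ a b))

lookup-t-matchʳ : (w : Word n) (a b : Fin n) → lookup (w t[ a , b ]) b ≡ lookup w a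
lookup-t-matchʳ w a b = trans (lookup-t w a b b) (cong (lookup w) (transpose-matchʳ a b))

lookup-t-fixed : (w : Word n) {a b c : Fin n} → c ≢ a → c ≢ b → lookup (w t[ a , b ]) c ≡ lookup w c
lookup-t-fixed w {a} {b} {c} c≢a c≢b = trans (lookup-t w a b c) (cong (lookup w) (transpose-fixed c≢a c≢b))

t-involutive : (w : Word n) (a b : Fin n) → (w t[ a , b ]) t[ a , b ] ≡ w
t-involutive w a b = lookup-ext _ w λ i → begin
  lookup ((w t[ a , b ]) t[ a , b ]) i      ≡⟨ lookup-t (w t[ a , b ]) a b i ⟩
  lookup (w t[ a , b ]) (transpose a b i)   ≡⟨ lookup-t w a b (transpose a b i) ⟩
  lookup w (transpose a b (transpose a b i)) ≡⟨ cong (lookup w) (transpose-involutive a b i) ⟩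
  lookup w i                                ∎
  where open ≡-Reasoning

t-conjugate : (w : Word n) {a b c : Fin n} → a ≢ c → c ≢ b → a ≢ b →
              ((w t[ a , c ]) t[ c , b ]) t[ a , c ] ≡ w t[ a , b ]
t-conjugate w {a} {b} {c} a≢c c≢b a≢b = lookup-ext _ _ λ i → begin
  lookup (((w t[ a , c ]) t[ c , b ]) t[ a , c ]) i       ≡⟨ lookup-t ((w t[ a , c ]) t[ c , b ]) a c i ⟩
  lookup ((w t[ a , c ]) t[ c , b ]) (transpose a c i)    ≡⟨ lookup-t (w t[ a , c ]) c b _ ⟩
  lookup (w t[ a , c ]) (transpose c b (transpose a c i)) ≡⟨ lookup-t w a c _ ⟩
  lookup w (transpose a c (transpose c b (transpose a c i))) ≡⟨ cong (lookup w) (transpose-conjugate a≢c c≢b a≢b i) ⟩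
  lookup w (transpose a b i)                              ≡⟨ lookup-t w a b i ⟨
  lookup (w t[ a , b ]) i                                 ∎
  where open ≡-Reasoning

IsPerm-t : (w : Word n) (a b : Fin n) → IsPerm w → IsPerm (w t[ a , b ])
IsPerm-t w a b w-perm i j eq = begin
  i                                      ≡⟨ transpose-involutive a b i ⟨
  transpose a b (transpose a b i)        ≡⟨ cong (transpose a b) (w-perm _ _ lookups) ⟩
  transpose a b (transpose a b j)        ≡⟨ transpose-involutive a b j ⟩
  j                                      ∎
  where
  open ≡-Reasoning
  lookups : lookup w (transpose a b i) ≡ lookup w (transpose a b j)
  lookups = trans (sym (lookup-t w a b i)) (trans eq (lookup-t w a b j))

lookup-≢ : (w : Word n) → IsPerm w → {x y : Fin n} → x ≢ y → lookup w x ≢ lookup w y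
lookup-≢ w w-perm x≢y = x≢y ∘ w-perm _ _

-- Inversion counts

𝟙 : Bool → ℕ
𝟙 b = if b then 1 else 0

module _ {p} {P : Pred A p} (P? : U.Decidable P) where

  count-tabulate : (f : Fin n → A) → length (filter P? (List.tabulate f)) ≡ ∑[ i < n ] 𝟙 (does (P? (f i)))
  count-tabulate {zero} f = refl
  count-tabulate {suc n} f with does (P? (f Fin.zero))
  ... | true = cong suc (count-tabulate (f ∘ Fin.suc))
  ... | false = count-tabulate (f ∘ Fin.suc)

module _ {p} {P : Pred (A × B) p} (P? : U.Decidable P) where

  count-cartesianProduct : (f : Fin m → A) (g : Fin n → B) →
    length (filter P? (cartesianProduct (List.tabulate f) (List.tabulate g)))
      ≡ ∑[ i < m ] ∑[ j < n ] 𝟙 (does (P? (f i , g j)))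
  count-cartesianProduct {zero} f g = refl
  count-cartesianProduct {suc m} {n} f g = begin
    length (filter P? (row ++ rest))                 ≡⟨ cong length (filter-++ P? row rest) ⟩
    length (filter P? row ++ filter P? rest)         ≡⟨ length-++ (filter P? row) ⟩
    length (filter P? row) + length (filter P? rest) ≡⟨ cong₂ _+_ count-row (count-cartesianProduct (f ∘ Fin.suc) g) ⟩
    _                                                ∎
    where
    open ≡-Reasoning
    row  = List.map (f Fin.zero ,_) (List.tabulate g)
    rest = cartesianProduct (List.tabulate (f ∘ Fin.suc)) (List.tabulate g)
    count-row : length (filter P? row) ≡ ∑[ j < n ] 𝟙 (does (P? (f Fin.zero , g j)))
    count-row = trans (cong (length ∘ filter P?) (map-tabulate g (f Fin.zero ,_)))
                      (count-tabulate P? (λ j → f Fin.zero , g j))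

inversion : (Fin n → Fin n) → Fin n → Fin n → ℕ
inversion g i j = 𝟙 (does (i <? j) ∧ does (g j <? g i))

ℓ≡∑inversion : (w : Word n) → ℓ w ≡ ∑[ i < n ] ∑[ j < n ] inversion (lookup w) i j
ℓ≡∑inversion w = count-cartesianProduct inverted? (λ i → i) (λ j → j)
  where
  inverted? = λ p → (proj₁ p <? proj₂ p) ×-dec (lookup w (proj₂ p) <? lookup w (proj₁ p))

point : Fin n → ℕ → Fin n → ℕ
point a x c = if does (c ≟ a) then x else 0

outside : Fin n → Fin n → (Fin n → ℕ) → Fin n → ℕ
outside a b f c = if does (c ≟ a) ∨ does (c ≟ b) then 0 else f c

∑-point : (a : Fin n) (x : ℕ) → sum (point a x) ≡ x
∑-point {suc n} Fin.zero x = trans (cong (x +_) (sum-replicate-zero n)) (+-identityʳ x)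
∑-point {suc n} (Fin.suc a) x = ∑-point a x

outside-+ : (a b : Fin n) (f g : Fin n → ℕ) (c : Fin n) →
            outside a b (λ d → f d + g d) c ≡ outside a b f c + outside a b g c
outside-+ a b f g c with does (c ≟ a) ∨ does (c ≟ b)
... | true  = refl
... | false = refl

∑-split₂ : {a b : Fin n} → a ≢ b → (f : Fin n → ℕ) → sum f ≡ (f a + f b) + sum (outside a b f)
∑-split₂ {a = a} {b} a≢b f = begin
  sum f                                                             ≡⟨ sum-cong-≗ pointwise ⟩
  sum (λ c → (point a (f a) c + point b (f b) c) + outside a b f c) ≡⟨ ∑-distrib-+ _ (outside a b f) ⟩
  sum (λ c → point a (f a) c + point b (f b) c) + sum (outside a b f)
    ≡⟨ cong (_+ sum (outside a b f)) (∑-distrib-+ (point a (f a)) (point b (f b))) ⟩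
  (sum (point a (f a)) + sum (point b (f b))) + sum (outside a b f)
    ≡⟨ cong₂ (λ x y → (x + y) + sum (outside a b f)) (∑-point a (f a)) (∑-point b (f b)) ⟩
  (f a + f b) + sum (outside a b f)                                 ∎
  where
  open ≡-Reasoning
  pointwise : ∀ c → f c ≡ (point a (f a) c + point b (f b) c) + outside a b f c
  pointwise c with c ≟ a | c ≟ b
  ... | yes refl | yes refl = ⊥-elim (a≢b refl)
  ... | yes refl | no _     = sym (trans (+-identityʳ _) (+-identityʳ _))
  ... | no _     | yes refl = sym (+-identityʳ _)
  ... | no _     | no _     = refl

outside-cong : (a b : Fin n) {f g : Fin n → ℕ} → (∀ c → c ≢ a → c ≢ b → f c ≡ g c) →
               ∀ c → outside a b f c ≡ outside a b g c
outside-cong a b f≗g c with c ≟ a | c ≟ b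
... | yes _   | _       = refl
... | no _    | yes _   = refl
... | no c≢a  | no c≢b  = f≗g c c≢a c≢b

within : Fin n → Fin n → (Fin n → Fin n → ℕ) → ℕ
within a b F = (F a a + F a b) + (F b a + F b b)

crossing : Fin n → Fin n → (Fin n → Fin n → ℕ) → Fin n → ℕ
crossing a b F c = (F c a + F c b) + (F a c + F b c)

avoiding : Fin n → Fin n → (Fin n → Fin n → ℕ) → Fin n → ℕ
avoiding a b F i = sum (outside a b (F i))

∑∑-split₂ : {a b : Fin n} → a ≢ b → (F : Fin n → Fin n → ℕ) →
  sum (λ i → sum (F i))
    ≡ within a b F + (sum (outside a b (crossing a b F)) + sum (outside a b (avoiding a b F)))
∑∑-split₂ {n = n} {a = a} {b} a≢b F = begin
  sum (λ i → sum (F i))                                          ≡⟨ sum-cong-≗ (λ i → ∑-split₂ a≢b (F i)) ⟩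
  sum (λ i → col i + inner i)                                    ≡⟨ ∑-distrib-+ col inner ⟩
  sum col + sum inner                                            ≡⟨ cong₂ _+_ (∑-split₂ a≢b col) (∑-split₂ a≢b inner) ⟩
  (col a + col b + sum (outside a b col)) + (inner a + inner b + sum (outside a b inner))
    ≡⟨ regroup (col a) (col b) (sum (outside a b col)) (inner a) (inner b) (sum (outside a b inner)) ⟩
  (col a + col b) + ((sum (outside a b col) + (inner a + inner b)) + sum (outside a b inner))
    ≡⟨ cong (λ x → (col a + col b) + (x + sum (outside a b inner))) crossing-sum ⟩
  (col a + col b) + (sum (outside a b (crossing a b F)) + sum (outside a b inner)) ∎
  where
  open ≡-Reasoning
  col inner row : Fin n → ℕ
  col c = F c a + F c b
  row c = F a c + F b c
  inner = avoiding a b F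
  regroup : ∀ x y z u v w → (x + y + z) + (u + v + w) ≡ (x + y) + ((z + (u + v)) + w)
  regroup = solve-∀
  crossing-sum : sum (outside a b col) + (inner a + inner b) ≡ sum (outside a b (crossing a b F))
  crossing-sum = begin
    sum (outside a b col) + (sum (outside a b (F a)) + sum (outside a b (F b)))
      ≡⟨ cong (sum (outside a b col) +_) (∑-distrib-+ (outside a b (F a)) (outside a b (F b))) ⟨
    sum (outside a b col) + sum (λ c → outside a b (F a) c + outside a b (F b) c)
      ≡⟨ cong (sum (outside a b col) +_) (sum-cong-≗ (λ c → outside-+ a b (F a) (F b) c)) ⟨
    sum (outside a b col) + sum (outside a b row)
      ≡⟨ ∑-distrib-+ (outside a b col) (outside a b row) ⟨
    sum (λ c → outside a b col c + outside a b row c)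
      ≡⟨ sum-cong-≗ (λ c → outside-+ a b col row c) ⟨
    sum (outside a b (crossing a b F)) ∎

-- The length of w t_ab

<?-flip : {x y : Fin n} → x ≢ y → does (y <? x) ≡ not (does (x <? y))
<?-flip {x = x} {y} x≢y with <-cmp x y
... | tri< x<y _ y≮x rewrite dec-true (x <? y) x<y | dec-false (y <? x) y≮x = refl
... | tri≈ _ x≡y _ = ⊥-elim (x≢y x≡y)
... | tri> x≮y _ y<x rewrite dec-false (x <? y) x≮y | dec-true (y <? x) y<x = refl

does-mono : (A → B) → (a? : Dec A) (b? : Dec B) → does a? Bool.≤ does b?
does-mono f (yes a) (yes _) = b≤b
does-mono f (yes a) (no ¬b) = ⊥-elim (¬b (f a))
does-mono f (no _)  (yes _) = f≤t
does-mono f (no _)  (no _)  = b≤b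

𝟙-xor : ∀ p v → 𝟙 (p ∧ not v) + 𝟙 (not p ∧ v) ≡ 𝟙 (p xor v)
𝟙-xor true  true  = refl
𝟙-xor true  false = refl
𝟙-xor false true  = refl
𝟙-xor false false = refl

inversion-pair : (g : Fin n → Fin n) {x y : Fin n} → x ≢ y → g x ≢ g y →
                 inversion g x y + inversion g y x ≡ 𝟙 (does (x <? y) xor does (g x <? g y))
inversion-pair g {x} {y} x≢y gx≢gy = trans
  (cong₂ (λ u v → 𝟙 (does (x <? y) ∧ u) + 𝟙 (v ∧ does (g x <? g y))) (<?-flip gx≢gy) (<?-flip x≢y))
  (𝟙-xor (does (x <? y)) (does (g x <? g y)))

𝟙-exchange : ∀ {p q r s} → q Bool.≤ p → s Bool.≤ r →
  𝟙 (p xor s) + 𝟙 (q xor r) ≡ (𝟙 (p xor r) + 𝟙 (q xor s)) + 2 * 𝟙 (p ∧ not q ∧ r ∧ not s)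
𝟙-exchange {true}  {r = true}  b≤b b≤b = refl
𝟙-exchange {true}  {r = false} b≤b b≤b = refl
𝟙-exchange {false} {r = true}  b≤b b≤b = refl
𝟙-exchange {false} {r = false} b≤b b≤b = refl
𝟙-exchange {true}  b≤b f≤t = refl
𝟙-exchange {false} b≤b f≤t = refl
𝟙-exchange {r = true}  f≤t b≤b = refl
𝟙-exchange {r = false} f≤t b≤b = refl
𝟙-exchange f≤t f≤t = refl

Between : Word n → (a b c : Fin n) → Set
Between w a b c = a < c × c < b × lookup w a < lookup w c × lookup w c < lookup w b

between? : (w : Word n) (a b c : Fin n) → Dec (Between w a b c)
between? w a b c = (a <? c) ×-dec (c <? b) ×-dec (lookup w a <? lookup w c) ×-dec (lookup w c <? lookup w b)

#between : Word n → Fin n → Fin n → ℕ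
#between {n} w a b = ∑[ c < n ] 𝟙 (does (between? w a b c))

inversions-within : (g : Fin n → Fin n) {a b : Fin n} → a < b → within a b (inversion g) ≡ 𝟙 (does (g b <? g a))
inversions-within g {a} {b} a<b
  rewrite dec-false (a <? a) (<-irrefl refl) | dec-true (a <? b) a<b
        | dec-false (b <? a) (<-asym a<b)    | dec-false (b <? b) (<-irrefl refl) = +-identityʳ _

module _ (w : Word n) (w-perm : IsPerm w) {a b : Fin n} (a<b : a < b) (wa<wb : lookup w a < lookup w b) where

  private
    g h : Fin n → Fin n
    g = lookup w
    h = lookup (w t[ a , b ])

  crossing-t : ∀ {c} → c ≢ a → c ≢ b →
    crossing a b (inversion h) c ≡ crossing a b (inversion g) c + 2 * 𝟙 (does (between? w a b c))
  crossing-t {c} c≢a c≢b = begin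
    crossing a b (inversion h) c                          ≡⟨ pair-up (inversion h) ⟩
    (inversion h a c + inversion h c a) + (inversion h b c + inversion h c b)
      ≡⟨ cong₂ _+_ (inversion-pair h a≢c (h-≢ a≢c)) (inversion-pair h b≢c (h-≢ b≢c)) ⟩
    𝟙 (p xor does (h a <? h c)) + 𝟙 (q xor does (h b <? h c))
      ≡⟨ cong₂ _+_ (cong₂ (λ x y → 𝟙 (p xor does (x <? y))) (lookup-t-matchˡ w a b) hc)
                   (cong₂ (λ x y → 𝟙 (q xor does (x <? y))) (lookup-t-matchʳ w a b) hc) ⟩
    𝟙 (p xor s) + 𝟙 (q xor r)                             ≡⟨ 𝟙-exchange q≤p s≤r ⟩
    (𝟙 (p xor r) + 𝟙 (q xor s)) + 2 * 𝟙 (p ∧ not q ∧ r ∧ not s)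
      ≡⟨ cong₂ _+_ (cong₂ _+_ (inversion-pair g a≢c (g-≢ a≢c)) (inversion-pair g b≢c (g-≢ b≢c)))
                   (cong (λ x → 2 * 𝟙 x) between-does) ⟨
    ((inversion g a c + inversion g c a) + (inversion g b c + inversion g c b)) + 2 * 𝟙 (does (between? w a b c))
      ≡⟨ cong (_+ 2 * 𝟙 (does (between? w a b c))) (pair-up (inversion g)) ⟨
    crossing a b (inversion g) c + 2 * 𝟙 (does (between? w a b c)) ∎
    where
    open ≡-Reasoning
    -- p, q: is c right of a, of b; r, s: is g c above g a, g b.  Passing to h exchanges r and s.
    p = does (a <? c)
    q = does (b <? c)
    r = does (g a <? g c)
    s = does (g b <? g c)
    a≢c : a ≢ c
    a≢c = c≢a ∘ sym
    b≢c : b ≢ c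
    b≢c = c≢b ∘ sym
    g-≢ : ∀ {x y} → x ≢ y → g x ≢ g y
    g-≢ = lookup-≢ w w-perm
    h-≢ : ∀ {x y} → x ≢ y → h x ≢ h y
    h-≢ = lookup-≢ (w t[ a , b ]) (IsPerm-t w a b w-perm)
    hc : h c ≡ g c
    hc = lookup-t-fixed w c≢a c≢b
    q≤p : q Bool.≤ p
    q≤p = does-mono (Fin.<-trans a<b) (b <? c) (a <? c)
    s≤r : s Bool.≤ r
    s≤r = does-mono (Fin.<-trans wa<wb) (g b <? g c) (g a <? g c)
    between-does : does (between? w a b c) ≡ p ∧ not q ∧ r ∧ not s
    between-does = cong₂ (λ x y → p ∧ x ∧ r ∧ y) (<?-flip b≢c) (<?-flip (g-≢ b≢c))
    pair-up : (F : Fin n → Fin n → ℕ) → crossing a b F c ≡ (F a c + F c a) + (F b c + F c b)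
    pair-up F = regroup (F c a) (F c b) (F a c) (F b c)
      where
      regroup : ∀ x y z u → (x + y) + (z + u) ≡ (z + x) + (u + y)
      regroup = solve-∀

  ∑crossing-t : sum (outside a b (crossing a b (inversion h)))
              ≡ sum (outside a b (crossing a b (inversion g))) + 2 * #between w a b
  ∑crossing-t = begin
    sum (outside a b (crossing a b (inversion h)))                   ≡⟨ sum-cong-≗ pointwise ⟩
    sum (λ c → outside a b (crossing a b (inversion g)) c + 2 * β c) ≡⟨ ∑-distrib-+ _ (λ c → 2 * β c) ⟩
    sum (outside a b (crossing a b (inversion g))) + sum (λ c → 2 * β c)
      ≡⟨ cong (sum (outside a b (crossing a b (inversion g))) +_) (*-distribˡ-sum 2 β) ⟨
    sum (outside a b (crossing a b (inversion g))) + 2 * #between w a b ∎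
    where
    open ≡-Reasoning
    β : Fin n → ℕ
    β c = 𝟙 (does (between? w a b c))
    pointwise : ∀ c → outside a b (crossing a b (inversion h)) c ≡ outside a b (crossing a b (inversion g)) c + 2 * β c
    pointwise c with c ≟ a | c ≟ b
    ... | yes refl | _        = sym (cong (λ x → 2 * 𝟙 x) (dec-false (between? w a b a) λ (a<a , _) → <-irrefl refl a<a))
    ... | no _     | yes refl = sym (cong (λ x → 2 * 𝟙 x) (dec-false (between? w a b b) λ (_ , b<b , _) → <-irrefl refl b<b))
    ... | no c≢a   | no c≢b   = crossing-t c≢a c≢b

  ∑avoiding-t : sum (outside a b (avoiding a b (inversion h))) ≡ sum (outside a b (avoiding a b (inversion g)))
  ∑avoiding-t = sum-cong-≗ (outside-cong a b λ i i≢a i≢b → sum-cong-≗ (outside-cong a b λ j j≢a j≢b →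
    cong₂ (λ x y → 𝟙 (does (i <? j) ∧ does (y <? x))) (lookup-t-fixed w i≢a i≢b) (lookup-t-fixed w j≢a j≢b)))

  ℓ-t : ℓ (w t[ a , b ]) ≡ suc (ℓ w + 2 * #between w a b)
  ℓ-t = begin
    ℓ (w t[ a , b ])                                  ≡⟨ ℓ≡∑inversion (w t[ a , b ]) ⟩
    sum (λ i → sum (inversion h i))                   ≡⟨ ∑∑-split₂ a≢b (inversion h) ⟩
    within a b (inversion h) + (sum (outside a b (crossing a b (inversion h))) + sum (outside a b (avoiding a b (inversion h))))
      ≡⟨ cong₂ _+_ (trans (inversions-within h a<b) corner-h) (cong₂ _+_ ∑crossing-t ∑avoiding-t) ⟩
    1 + ((X + 2 * #between w a b) + I)                ≡⟨ regroup X I (#between w a b) ⟩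
    suc ((X + I) + 2 * #between w a b)                ≡⟨ cong (λ x → suc (x + 2 * #between w a b)) ℓ-w ⟨
    suc (ℓ w + 2 * #between w a b)                    ∎
    where
    open ≡-Reasoning
    X = sum (outside a b (crossing a b (inversion g)))
    I = sum (outside a b (avoiding a b (inversion g)))
    a≢b = <⇒≢ a<b
    corner-h : 𝟙 (does (h b <? h a)) ≡ 1
    corner-h = begin
      𝟙 (does (h b <? h a)) ≡⟨ cong₂ (λ x y → 𝟙 (does (x <? y))) (lookup-t-matchʳ w a b) (lookup-t-matchˡ w a b) ⟩
      𝟙 (does (g a <? g b)) ≡⟨ cong 𝟙 (dec-true (g a <? g b) wa<wb) ⟩
      1                     ∎
    ℓ-w : ℓ w ≡ X + I
    ℓ-w = begin
      ℓ w                                ≡⟨ ℓ≡∑inversion w ⟩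
      sum (λ i → sum (inversion g i))    ≡⟨ ∑∑-split₂ a≢b (inversion g) ⟩
      within a b (inversion g) + (X + I) ≡⟨ cong (_+ (X + I)) (inversions-within g a<b) ⟩
      𝟙 (does (g b <? g a)) + (X + I)    ≡⟨ cong (λ x → 𝟙 x + (X + I)) (dec-false (g b <? g a) (<-asym wa<wb)) ⟩
      X + I                              ∎
    regroup : ∀ x i k → 1 + ((x + 2 * k) + i) ≡ suc ((x + i) + 2 * k)
    regroup = solve-∀

ℓ-t-increasing : (w : Word n) → IsPerm w → {a b : Fin n} → a < b → lookup w a < lookup w b →
                 ℓ w ℕ.< ℓ (w t[ a , b ])
ℓ-t-increasing w w-perm a<b wa<wb = ≤-trans (s≤s (m≤m+n (ℓ w) _)) (≤-reflexive (sym (ℓ-t w w-perm a<b wa<wb)))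

module _ (w : Word n) (w-perm : IsPerm w) {a b : Fin n} (a<b : a < b) where

  t-covers : lookup w a < lookup w b → (∀ c → ¬ Between w a b c) → w ⋖ (w t[ a , b ])
  t-covers wa<wb none = a , b , a<b , refl , ℓ-suc
    where
    open ≡-Reasoning
    no-between : #between w a b ≡ 0
    no-between = trans (sum-cong-≗ (λ c → cong 𝟙 (dec-false (between? w a b c) (none c)))) (sum-replicate-zero n)
    ℓ-suc : ℓ (w t[ a , b ]) ≡ suc (ℓ w)
    ℓ-suc = begin
      ℓ (w t[ a , b ])               ≡⟨ ℓ-t w w-perm a<b wa<wb ⟩
      suc (ℓ w + 2 * #between w a b) ≡⟨ cong (λ k → suc (ℓ w + 2 * k)) no-between ⟩
      suc (ℓ w + 0)                  ≡⟨ cong suc (+-identityʳ (ℓ w)) ⟩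
      suc (ℓ w)                      ∎

  ℓ-increasing⇒ascending : ℓ w ℕ.< ℓ (w t[ a , b ]) → lookup w a < lookup w b
  ℓ-increasing⇒ascending ℓ< with <-cmp (lookup w a) (lookup w b)
  ... | tri< wa<wb _ _ = wa<wb
  ... | tri≈ _ wa≡wb _ = ⊥-elim (<⇒≢ a<b (w-perm a b wa≡wb))
  ... | tri> _ _ wb<wa = ⊥-elim (ℕ.<-asym ℓ< (subst (λ v → ℓ (w t[ a , b ]) ℕ.< ℓ v) (t-involutive w a b) ℓ>))
    where
    ℓ> : ℓ (w t[ a , b ]) ℕ.< ℓ ((w t[ a , b ]) t[ a , b ])
    ℓ> = ℓ-t-increasing (w t[ a , b ]) (IsPerm-t w a b w-perm) a<b
           (subst₂ _<_ (sym (lookup-t-matchˡ w a b)) (sym (lookup-t-matchʳ w a b)) wb<wa)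

-- Refining Bruhat steps to covers

Star-unsnoc : ∀ {a t} {A : Set a} {T : Rel A t} {x z : A} → Star T x z → x ≡ z ⊎ ∃[ y ] (Star T x y × T y z)
Star-unsnoc ε = inj₁ refl
Star-unsnoc (t ◅ ts) with Star-unsnoc ts
... | inj₁ refl          = inj₂ (_ , ε , t)
... | inj₂ (y , ts′ , t′) = inj₂ (y , t ◅ ts′ , t′)

≤B-IsPerm : {u v : Word n} → u ≤B v → IsPerm u → IsPerm v
≤B-IsPerm ε u-perm = u-perm
≤B-IsPerm {u = u} ((a , b , _ , refl , _) ◅ steps) u-perm = ≤B-IsPerm steps (IsPerm-t u a b u-perm)

≤B-ℓ : {u v : Word n} → u ≤B v → ℓ u ≤ ℓ v
≤B-ℓ ε = ℕ.≤-refl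
≤B-ℓ ((_ , _ , _ , refl , ℓ<) ◅ steps) = ≤-trans (<⇒≤ ℓ<) (≤B-ℓ steps)

ascending⇒lower-cover : (z : Word n) → IsPerm z → {a b : Fin n} → a < b → lookup z a < lookup z b →
                        ∃[ y ] (z ≤B y × y ⋖ (z t[ a , b ]))
ascending⇒lower-cover {n = n} z z-perm {a} {b} = go (Fin.<-wellFounded b) z z-perm
  where
  go : ∀ {b} → Acc _<_ b → (z : Word n) → IsPerm z → a < b → lookup z a < lookup z b →
       ∃[ y ] (z ≤B y × y ⋖ (z t[ a , b ]))
  go {b} (acc smaller) z z-perm a<b za<zb with any? (between? z a b)
  ... | no none = z , ε , t-covers z z-perm a<b za<zb (λ c between → none (c , between))
  -- t_ab = t_ac t_cb t_ac, whose first two factors go up because c lies in between.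
  ... | yes (c , a<c , c<b , za<zc , zc<zb) =
        y , up₁ ◅ up₂ ◅ z₂≤y , subst (y ⋖_) (t-conjugate z (<⇒≢ a<c) (<⇒≢ c<b) (<⇒≢ a<b)) y⋖
    where
    z₁ = z t[ a , c ]
    z₂ = z₁ t[ c , b ]
    z₁-perm = IsPerm-t z a c z-perm
    z₁c≡za : lookup z₁ c ≡ lookup z a
    z₁c≡za = lookup-t-matchʳ z a c
    z₁b≡zb : lookup z₁ b ≡ lookup z b
    z₁b≡zb = lookup-t-fixed z (<⇒≢ (Fin.<-trans a<c c<b) ∘ sym) (<⇒≢ c<b ∘ sym)
    up₁ : BruhatStep z z₁
    up₁ = a , c , a<c , refl , ℓ-t-increasing z z-perm a<c za<zc
    up₂ : BruhatStep z₁ z₂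
    up₂ = c , b , c<b , refl , ℓ-t-increasing z₁ z₁-perm c<b (subst₂ _<_ (sym z₁c≡za) (sym z₁b≡zb) za<zb)
    z₂a≡zc : lookup z₂ a ≡ lookup z c
    z₂a≡zc = trans (lookup-t-fixed z₁ (<⇒≢ a<c) (<⇒≢ (Fin.<-trans a<c c<b))) (lookup-t-matchˡ z a c)
    z₂c≡zb : lookup z₂ c ≡ lookup z b
    z₂c≡zb = trans (lookup-t-matchˡ z₁ c b) z₁b≡zb
    z₂a<z₂c : lookup z₂ a < lookup z₂ c
    z₂a<z₂c = subst₂ _<_ (sym z₂a≡zc) (sym z₂c≡zb) zc<zb
    lower = go (smaller c<b) z₂ (IsPerm-t z₁ c b z₁-perm) a<c z₂a<z₂c
    y = proj₁ lower
    z₂≤y = proj₁ (proj₂ lower)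
    y⋖ = proj₂ (proj₂ lower)

BruhatStep⇒lower-cover : (z : Word n) → IsPerm z → {x : Word n} → BruhatStep z x → ∃[ y ] (z ≤B y × y ⋖ x)
BruhatStep⇒lower-cover z z-perm (a , b , a<b , refl , ℓ<) =
  ascending⇒lower-cover z z-perm a<b (ℓ-increasing⇒ascending z z-perm a<b ℓ<)

_≤B?_ : (u v : Word n) → Dec (u ≤B v)
u ≤B? v = bounded (suc (ℓ v)) u (s≤s (ℕ.m≤m+n (ℓ v) (ℓ u)))
  where
  -- every step increases ℓ, so no path from u to v is longer than ℓ v ∸ ℓ u
  bounded : ∀ k u → ℓ v ℕ.< k + ℓ u → Dec (u ≤B v)
  bounded zero u ℓv<ℓu = no λ u≤v → ℕ.<⇒≱ ℓv<ℓu (≤B-ℓ u≤v)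
  bounded (suc k) u ℓv<k+ℓu with ≡-dec Fin._≟_ u v
  ... | yes refl = yes ε
  ... | no u≢v = map′ (λ (a , b , a<b , ℓ< , t≤v) → (a , b , a<b , refl , ℓ<) ◅ t≤v) first-step
                      (any? λ a → any? λ b → (a <? b) ×-dec up-then-below a b)
    where
    first-step : u ≤B v → ∃[ a ] ∃[ b ] (a < b × ℓ u ℕ.< ℓ (u t[ a , b ]) × (u t[ a , b ]) ≤B v)
    first-step ε = ⊥-elim (u≢v refl)
    first-step ((a , b , a<b , refl , ℓ<) ◅ t≤v) = a , b , a<b , ℓ< , t≤v
    up-then-below : ∀ a b → Dec (ℓ u ℕ.< ℓ (u t[ a , b ]) × (u t[ a , b ]) ≤B v)
    up-then-below a b with ℓ u ℕ.<? ℓ (u t[ a , b ])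
    ... | no ℓ≮ = no (ℓ≮ ∘ proj₁)
    ... | yes ℓ< = map′ (ℓ< ,_) proj₂
                     (bounded k (u t[ a , b ]) (ℕ.≤-<-trans (ℕ.s≤s⁻¹ ℓv<k+ℓu) (ℕ.+-monoʳ-< k ℓ<)))

-- Greedy chains

module _ {r} {_≺_ : Rel (Fin n) r} (_≺?_ : Decidable _≺_) (≺-wellFounded : WellFounded _≺_)
         {p} {P : Pred (Fin n) p} (P? : U.Decidable P) where

  ≺-minimal : ∀ {x} → P x → ∃[ y ] (P y × ∀ z → z ≺ y → ¬ P z)
  ≺-minimal {x} = go (≺-wellFounded x)
    where
    go : ∀ {x} → Acc _≺_ x → P x → ∃[ y ] (P y × ∀ z → z ≺ y → ¬ P z)
    go {x} (acc smaller) px with any? (λ z → (z ≺? x) ×-dec P? z)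
    ... | yes (z , z≺x , pz) = go (smaller z≺x) pz
    ... | no none            = x , px , λ z z≺x pz → none (z , z≺x , pz)

module Greedy {n} (u w : Word n) (u-perm : IsPerm u) where

  LowerCover : Word n → Fin n → Fin n → Set
  LowerCover x a b = a < b × ℓ x ≡ suc (ℓ (x t[ a , b ])) × u ≤B (x t[ a , b ])

  lowerCover? : ∀ x a b → Dec (LowerCover x a b)
  lowerCover? x a b = (a <? b) ×-dec (ℓ x ℕ.≟ suc (ℓ (x t[ a , b ]))) ×-dec (u ≤B? (x t[ a , b ]))

  cover⇒LowerCover : ∀ {x y a b} → u ≤B y → y ⋖ x → a < b → x ≡ y t[ a , b ] → LowerCover x a b
  cover⇒LowerCover {y = y} {a} {b} u≤y (_ , _ , _ , _ , ℓx≡) a<b refl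
    rewrite t-involutive y a b = a<b , ℓx≡ , u≤y

  lowerCover-exists : ∀ {x z} → u ≤B z → BruhatStep z x → ∃[ a ] ∃[ b ] LowerCover x a b
  lowerCover-exists {z = z} u≤z z→x with BruhatStep⇒lower-cover z (≤B-IsPerm u≤z u-perm) z→x
  ... | y , z≤y , y⋖x@(a , b , a<b , x≡ , _) = a , b , cover⇒LowerCover (u≤z ◅◅ z≤y) y⋖x a<b x≡

  extremal-lowerCover-greedy : ∀ {x} → ∃[ a ] ∃[ b ] LowerCover x a b →
                               ∃[ a ] ∃[ b ] (LowerCover x a b × GreedyStep u w x a b)
  extremal-lowerCover-greedy {x} (a₀ , cover₀) = a , b , cover , greedy
    where
    leftmost = ≺-minimal _<?_ Fin.<-wellFounded (λ a → any? (lowerCover? x a)) cover₀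
    a = proj₁ leftmost
    rightmost = ≺-minimal (λ b c → c <? b) Fin.>-wellFounded (lowerCover? x a) (proj₂ (proj₁ (proj₂ leftmost)))
    b = proj₁ rightmost
    cover : LowerCover x a b
    cover = proj₁ (proj₂ rightmost)
    greedy : GreedyStep u w x a b
    greedy (y , (u≤y , _) , y⋖x , inj₁ (b′ , b<b′ , x≡)) =
      proj₂ (proj₂ rightmost) b′ b<b′ (cover⇒LowerCover u≤y y⋖x (Fin.<-trans (proj₁ cover) b<b′) x≡)
    greedy (y , (u≤y , _) , y⋖x , inj₂ (a′ , a′<a , x≡)) =
      proj₂ (proj₂ leftmost) a′ a′<a (b , cover⇒LowerCover u≤y y⋖x (Fin.<-trans a′<a (proj₁ cover)) x≡)

  greedyChain : ∀ x → Acc (ℕ._<_ on ℓ) x → u ≤B x → x ≤B w → GreedyChain u w x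
  greedyChain x (acc smaller) u≤x x≤w with Star-unsnoc u≤x
  ... | inj₁ refl = start
  ... | inj₂ (z , u≤z , z→x) = descend (extremal-lowerCover-greedy (lowerCover-exists u≤z z→x))
    where
    descend : ∃[ a ] ∃[ b ] (LowerCover x a b × GreedyStep u w x a b) → GreedyChain u w x
    descend (a , b , (a<b , ℓx≡ , u≤x′) , greedy) =
      step (greedyChain x′ (smaller ℓx′<ℓx) u≤x′ (down ◅ x≤w))
           a b a<b (sym (t-involutive x a b)) ℓx≡ greedy
      where
      x′ = x t[ a , b ]
      ℓx′<ℓx : ℓ x′ ℕ.< ℓ x
      ℓx′<ℓx = ≤-reflexive (sym ℓx≡)
      down : BruhatStep x′ x
      down = a , b , a<b , sym (t-involutive x a b) , ℓx′<ℓx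

lemma3p8 : (n : ℕ) (u w : Word n) → IsPerm u → IsPerm w → u ≤B w → GreedyChain u w w
lemma3p8 n u w u-perm _ u≤w = Greedy.greedyChain u w u-perm w (On.wellFounded ℓ ℕ.<-wellFounded w) u≤w ε
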